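{- Let $L$ be a finite comodernistic lattice. Then $L$ has a $CL$-labeling.
   Context: All lattices are finite. An element $m$ of a lattice $L$ is left-modular if $(x\vee m)\wedge y=x\vee(m\wedge y)$ for all $x<y$ in $L$. A lattice is comodernistic if every interval $[u,v]$ of it has a coatom which is left-modular as an element of the lattice $[u,v]$. Write $x\lessdot y$ if $y$ covers $x$. A rooted cover relation is a cover relation $x\lessdot y$ together with a maximal chain from $\hat{0}$ to $x$ (the root); a rooted interval $[x,y]_{\mathbf r}$ is an interval together with a maximal chain $\mathbf r$ from $\hat 0$ to $x$. A chain-edge labeling assigns an integer to each rooted cover relation; each maximal chain $x=x_0\lessdot x_1\lessdot\cdots\lessdot x_k=y$ of a rooted interval $[x,y]_{\mathbf r}$ then gets the word whose $j$-th letter is the label of $x_{j-1}\lessdot x_j$ rooted at $\mathbf r\cup\{x_1,\dots,x_{j-1}\}$. A maximal chain is increasing if its word is strictly increasing; maximal chains are compared by lexicographic order of their words. A $CL$-labeling is a chain-edge labeling such that in every rooted interval $[x,y]_{\mathbf r}$ there is a unique increasing maximal chain, and it is strictly lexicographically earlier than every other maximal chain of $[x,y]_{\mathbf r}$. -}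

module Defs where

open import Level using (0ℓ)
open import Data.Nat using (ℕ)
open import Data.Fin using (Fin)
open import Data.Integer using (ℤ) renaming (_<_ to _<ℤ_)
open import Data.List using (List; []; _∷_; _++_; [_])
open import Data.List.Relation.Unary.Linked using (Linked)
open import Data.List.Relation.Binary.Lex.Strict using (Lex-<)
open import Data.Product using (Σ; _×_; ∃; ∃-syntax)
open import Relation.Nullary using (¬_)
open import Relation.Binary.Core using (Rel)
open import Relation.Binary.PropositionalEquality using (_≡_; _≢_)
open import Relation.Binary.Lattice.Structures using (IsBoundedLattice)

-- A finite (bounded) lattice.  Every finite (nonempty) lattice is isomorphic to
-- one whose carrier is Fin n with propositional equality.
record FiniteLattice : Set₁ where
  field
    n     : ℕ
    _≤_   : Rel (Fin n) 0ℓ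
    _∨_   : Fin n → Fin n → Fin n
    _∧_   : Fin n → Fin n → Fin n
    top   : Fin n
    bot   : Fin n
    isBoundedLattice : IsBoundedLattice _≡_ _≤_ _∨_ _∧_ top bot

  Carrier : Set
  Carrier = Fin n

  _<_ : Carrier → Carrier → Set
  x < y = (x ≤ y) × (x ≢ y)

  _⋖_ : Carrier → Carrier → Set
  x ⋖ y = (x < y) × (∀ z → ¬ ((x < z) × (z < y)))

  -- Sat x zs y : the chain x ⋖ z₁ ⋖ z₂ ⋖ ⋯ ⋖ z_k = y where zs = [z₁,…,z_k]
  -- (zs = [] means x ≡ y).  These are exactly the maximal chains of [x,y].
  Sat : Carrier → List Carrier → Carrier → Set
  Sat x []       y = x ≡ y
  Sat x (z ∷ zs) y = (x ⋖ z) × Sat z zs y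

  LeftModularIn : Carrier → Carrier → Carrier → Set
  LeftModularIn u v m =
    ∀ x y → u ≤ x → y ≤ v → x < y → ((x ∨ m) ∧ y) ≡ (x ∨ (m ∧ y))

  Comodernistic : Set
  Comodernistic =
    ∀ u v → u < v → ∃[ m ] ((u ≤ m) × (m ⋖ v) × LeftModularIn u v m)

  -- A chain-edge labeling: λ rs y is the label of the cover x ⋖ y rooted at the
  -- maximal chain bot ⋖ r₁ ⋖ ⋯ ⋖ r_k = x, where rs = [r₁,…,r_k] (rs = [] means x = bot).
  -- Values on arguments that are not rooted covers are irrelevant.
  ChainEdgeLabeling : Set
  ChainEdgeLabeling = List Carrier → Carrier → ℤ

  word : ChainEdgeLabeling → List Carrier → List Carrier → List ℤ
  word lab rs []       = []
  word lab rs (z ∷ zs) = lab rs z ∷ word lab (rs ++ [ z ]) zs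

  Increasing : List ℤ → Set
  Increasing = Linked _<ℤ_

  -- strict lexicographic order (a proper prefix is smaller)
  _<lex_ : List ℤ → List ℤ → Set
  _<lex_ = Lex-< _≡_ _<ℤ_

  IsCL : ChainEdgeLabeling → Set
  IsCL lab =
    ∀ x y rs → Sat bot rs x → x ≤ y →
      ∃[ cs ] ( Sat x cs y
              × Increasing (word lab rs cs)
              × (∀ ds → Sat x ds y → Increasing (word lab rs ds) → ds ≡ cs)
              × (∀ ds → Sat x ds y → ds ≢ cs → word lab rs cs <lex word lab rs ds))

  HasCLLabeling : Set
  HasCLLabeling = Σ ChainEdgeLabeling IsCL

-- Choose a left-modular coatom m of [u,v] and label recursively: covers inside ↓m as in [u,m],
-- the cover by which a chain leaves ↓m by a label larger than all others, and the covers after it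
-- as in [a,v], where a is the element at which the root left ↓m.  If a rooted interval [x,y]
-- has x ≤ m and y ≰ m, every maximal chain leaves ↓m through exactly one cover, so an increasing
-- chain does so at its last step; left-modularity makes m ∧ y a coatom of y, so the increasing
-- chain is the one of [x, m ∧ y] followed by y, and it is lexicographically first because the
-- large label comes as late as possible.  The other rooted intervals lie in [u,m] or in [a,v].

module Submission where

open import Defs
open import Level using (0ℓ; _⊔_)
open import Data.Nat as ℕ using (ℕ; zero; suc)
import Data.Nat.Properties as ℕₚ
open import Data.Integer using (ℤ; +_; +≤+; +<+) renaming (_<_ to _<ℤ_; _≤_ to _≤ℤ_)
import Data.Integer.Properties as ℤₚ
open import Data.Fin using (Fin) renaming (_≟_ to _≟ᶠ_)
open import Data.Fin.Subset using (Subset; _∈_; ∣_∣)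
open import Data.Fin.Subset.Properties using (p⊂q⇒∣p∣<∣q∣)
open import Data.Vec using (tabulate)
open import Data.Vec.Properties using (lookup∘tabulate; lookup⇒[]=; []=⇒lookup)
open import Data.List using (List; []; _∷_; _++_; [_]; _∷ʳ_; dropWhile)
open import Data.List.Properties using (++-assoc; ++-identityʳ; ≡-dec)
open import Data.List.Relation.Unary.All as All using (All; []; _∷_)
open import Data.List.Relation.Unary.All.Properties using (++⁺)
open import Data.List.Relation.Unary.Linked as Linked using (Linked; []; [-]; _∷_)
open import Data.List.Relation.Binary.Lex.Strict using (Lex-<; this; next)
open import Data.Product using (_×_; _,_; proj₁; proj₂; ∃-syntax)
open import Function using (_∘_)
open import Relation.Nullary using (¬_; Dec; yes; no; does; contradiction)
open import Relation.Nullary.Decidable using (dec-true; _×-dec_)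
open import Relation.Unary using (Pred; Decidable; _⊆_)
open import Relation.Binary.Core using (Rel)
open import Relation.Binary.PropositionalEquality
  using (_≡_; _≢_; refl; sym; trans; cong; cong₂; subst; subst₂; module ≡-Reasoning)
open import Relation.Binary.Lattice.Structures using (IsBoundedLattice)

module _ {n ℓ} {P : Pred (Fin n) ℓ} (P? : Decidable P) where

  toSubset : Subset n
  toSubset = tabulate (does ∘ P?)

  ∈-toSubset⁺ : ∀ {x} → P x → x ∈ toSubset
  ∈-toSubset⁺ {x} px =
    lookup⇒[]= x toSubset (trans (lookup∘tabulate _ x) (dec-true (P? x) px))

  ∈-toSubset⁻ : ∀ {x} → x ∈ toSubset → P x
  ∈-toSubset⁻ {x} x∈ with P? x | trans (sym (lookup∘tabulate (does ∘ P?) x)) ([]=⇒lookup x∈)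
  ... | yes px | _ = px

∣toSubset∣-< : ∀ {n ℓ} {P Q : Pred (Fin n) ℓ} (P? : Decidable P) (Q? : Decidable Q) →
               P ⊆ Q → ∀ {w} → Q w → ¬ P w → (∣ toSubset P? ∣) ℕ.< (∣ toSubset Q? ∣)
∣toSubset∣-< P? Q? P⊆Q {w} qw ¬pw = p⊂q⇒∣p∣<∣q∣
  (∈-toSubset⁺ Q? ∘ P⊆Q ∘ ∈-toSubset⁻ P? , w , ∈-toSubset⁺ Q? qw , ¬pw ∘ ∈-toSubset⁻ P?)

module _ {a ℓ} {A : Set a} {P : Pred A ℓ} (P? : Decidable P) where

  dropWhile-++-All : ∀ {xs} ys → All P xs → dropWhile P? (xs ++ ys) ≡ dropWhile P? ys
  dropWhile-++-All ys [] = refl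
  dropWhile-++-All {x ∷ xs} ys (px ∷ pxs) with P? x
  ... | yes _  = dropWhile-++-All ys pxs
  ... | no ¬px = contradiction px ¬px

  dropWhile-All : ∀ {xs} → All P xs → dropWhile P? xs ≡ []
  dropWhile-All [] = refl
  dropWhile-All {x ∷ xs} (px ∷ pxs) with P? x
  ... | yes _  = dropWhile-All pxs
  ... | no ¬px = contradiction px ¬px

  dropWhile-++-∷ : ∀ xs {y ys} zs → dropWhile P? xs ≡ y ∷ ys →
                   dropWhile P? (xs ++ zs) ≡ y ∷ ys ++ zs
  dropWhile-++-∷ (x ∷ xs) zs eq with P? x
  ... | yes _ = dropWhile-++-∷ xs zs eq
  dropWhile-++-∷ (x ∷ xs) zs refl | no _ = refl

  dropWhile-¬ : ∀ {x} xs → ¬ P x → dropWhile P? (x ∷ xs) ≡ x ∷ xs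
  dropWhile-¬ {x} xs ¬px with P? x
  ... | yes px = contradiction px ¬px
  ... | no _   = refl

module _ {a ℓ} {A : Set a} {R : Rel A ℓ} where

  Linked-++⁻ˡ : ∀ xs {ys} → Linked R (xs ++ ys) → Linked R xs
  Linked-++⁻ˡ []           _         = []
  Linked-++⁻ˡ (x ∷ [])     _         = [-]
  Linked-++⁻ˡ (x ∷ y ∷ xs) (r ∷ rxs) = r ∷ Linked-++⁻ˡ (y ∷ xs) rxs

  Linked-++⁻ʳ : ∀ xs {ys} → Linked R (xs ++ ys) → Linked R ys
  Linked-++⁻ʳ []       rys = rys
  Linked-++⁻ʳ (x ∷ xs) rys = Linked-++⁻ʳ xs (Linked.tail rys)

  Linked-∷ʳ : ∀ {y} xs → Linked R xs → All (λ x → R x y) xs → Linked R (xs ∷ʳ y)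
  Linked-∷ʳ []            _         _           = [-]
  Linked-∷ʳ (x ∷ [])      _         (rxy ∷ _)   = rxy ∷ [-]
  Linked-∷ʳ (x ∷ x′ ∷ xs) (r ∷ rxs) (_ ∷ rxs-y) = r ∷ Linked-∷ʳ (x′ ∷ xs) rxs rxs-y

module FirstDifference {a ℓ} {A : Set a} (_<_ : Rel A ℓ) where

  -- Unlike Lex-< (where a proper prefix is smaller), _≺_ requires the words to differ at a
  -- common position, which makes it stable under appending suffixes.
  infix 4 _≺_
  data _≺_ : List A → List A → Set (a ⊔ ℓ) where
    here  : ∀ {x y xs ys} → x < y → (x ∷ xs) ≺ (y ∷ ys)
    there : ∀ {x xs ys} → xs ≺ ys → (x ∷ xs) ≺ (x ∷ ys)

  ≺-++ˡ : ∀ ws {xs ys} → xs ≺ ys → (ws ++ xs) ≺ (ws ++ ys)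
  ≺-++ˡ []       xs≺ys = xs≺ys
  ≺-++ˡ (w ∷ ws) xs≺ys = there (≺-++ˡ ws xs≺ys)

  ≺-insert : ∀ {k xs} ys {zs} ws → All (_< k) xs → xs ≺ (ys ++ zs) → (xs ∷ʳ k) ≺ (ys ++ k ∷ ws)
  ≺-insert []       ws (x<k ∷ _)  _            = here x<k
  ≺-insert (y ∷ ys) ws _          (here x<y)   = here x<y
  ≺-insert (y ∷ ys) ws (_ ∷ xs<k) (there xs≺)  = there (≺-insert ys ws xs<k xs≺)

  ≺⇒Lex-< : ∀ {xs ys} → xs ≺ ys → Lex-< _≡_ _<_ xs ys
  ≺⇒Lex-< (here x<y)    = this x<y
  ≺⇒Lex-< (there xs≺ys) = next refl (≺⇒Lex-< xs≺ys)

module Chains (L : FiniteLattice) where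

  open FiniteLattice L
  open IsBoundedLattice isBoundedLattice public
    using (antisym; maximum; x∧y≤x; x∧y≤y; ∧-greatest; x≤x∨y; y≤x∨y; ∨-least)
    renaming (refl to ≤-refl; trans to ≤-trans)

  _≤?_ : ∀ x y → Dec (x ≤ y)
  x ≤? y with (x ∧ y) ≟ᶠ x
  ... | yes x∧y≡x = yes (subst (_≤ y) x∧y≡x (x∧y≤y x y))
  ... | no  x∧y≢x = no (λ x≤y → x∧y≢x (antisym (x∧y≤x x y) (∧-greatest ≤-refl x≤y)))

  _<?_ : ∀ x y → Dec (x < y)
  x <? y with x ≤? y | x ≟ᶠ y
  ... | yes x≤y | no x≢y = yes (x≤y , x≢y)
  ... | yes _   | yes x≡y = no (λ x<y → proj₂ x<y x≡y)
  ... | no x≰y  | _       = no (x≰y ∘ proj₁)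

  <-≤-trans : ∀ {x y z} → x < y → y ≤ z → x < z
  <-≤-trans (x≤y , x≢y) y≤z = ≤-trans x≤y y≤z , λ { refl → x≢y (antisym x≤y y≤z) }

  ≤-<-trans : ∀ {x y z} → x ≤ y → y < z → x < z
  ≤-<-trans x≤y (y≤z , y≢z) = ≤-trans x≤y y≤z , λ { refl → y≢z (antisym y≤z x≤y) }

  ⋖-≤-<⇒≡ : ∀ {p q y} → p ⋖ y → p ≤ q → q < y → p ≡ q
  ⋖-≤-<⇒≡ {p} {q} (_ , nothing-between) p≤q q<y with p ≟ᶠ q
  ... | yes p≡q = p≡q
  ... | no  p≢q = contradiction ((p≤q , p≢q) , q<y) (nothing-between q)

  -- For a < y above m ∧ y, the join a ∨ m lies in [m,v]; it is not m (else a ≤ m ∧ y),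
  -- not v (else left-modularity gives a = a ∨ (m ∧ y) = (a ∨ m) ∧ y = v ∧ y = y), and m ⋖ v.
  ∧-⋖ : ∀ {u v m y} → LeftModularIn u v m → u ≤ m → m ⋖ v → u ≤ y → y ≤ v → ¬ y ≤ m →
        (m ∧ y) ⋖ y
  ∧-⋖ {u} {v} {m} {y} leftModular u≤m ((m≤v , _) , m⋖v) u≤y y≤v y≰m = m∧y<y , nothing-between
    where
    m∧y<y : (m ∧ y) < y
    m∧y<y = x∧y≤y m y , λ m∧y≡y → y≰m (subst (_≤ m) m∧y≡y (x∧y≤x m y))

    nothing-between : ∀ a → ¬ (((m ∧ y) < a) × (a < y))
    nothing-between a ((m∧y≤a , m∧y≢a) , (a≤y , a≢y)) with (a ∨ m) ≟ᶠ m | (a ∨ m) ≟ᶠ v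
    ... | yes a∨m≡m | _ =
      m∧y≢a (antisym m∧y≤a (∧-greatest (subst (a ≤_) a∨m≡m (x≤x∨y a m)) a≤y))
    ... | no _ | yes a∨m≡v = a≢y (begin
      a                 ≡⟨ antisym (x≤x∨y a (m ∧ y)) (∨-least ≤-refl m∧y≤a) ⟩
      a ∨ (m ∧ y)       ≡⟨ sym (leftModular a y u≤a y≤v (a≤y , a≢y)) ⟩
      (a ∨ m) ∧ y       ≡⟨ cong (_∧ y) a∨m≡v ⟩
      v ∧ y             ≡⟨ antisym (x∧y≤y v y) (∧-greatest y≤v ≤-refl) ⟩
      y                 ∎)
      where
      open ≡-Reasoning
      u≤a : u ≤ a
      u≤a = ≤-trans (∧-greatest u≤m u≤y) m∧y≤a
    ... | no a∨m≢m | no a∨m≢v = m⋖v (a ∨ m)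
      ((y≤x∨y a m , a∨m≢m ∘ sym) , (∨-least (≤-trans a≤y y≤v) m≤v , a∨m≢v))

  Sat⇒≤ : ∀ {x cs y} → Sat x cs y → x ≤ y
  Sat⇒≤ {cs = []}    refl              = ≤-refl
  Sat⇒≤ {cs = _ ∷ _} (((x≤z , _) , _) , z⋯y) = ≤-trans x≤z (Sat⇒≤ z⋯y)

  Sat⇒All-≤ : ∀ {x cs y} → Sat x cs y → All (_≤ y) cs
  Sat⇒All-≤ {cs = []}    _          = []
  Sat⇒All-≤ {cs = _ ∷ _} (_ , z⋯y) = Sat⇒≤ z⋯y ∷ Sat⇒All-≤ z⋯y

  Sat⇒All-≥ : ∀ {x cs y} → Sat x cs y → All (x ≤_) cs
  Sat⇒All-≥ {cs = []}    _                          = []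
  Sat⇒All-≥ {cs = _ ∷ _} (((x≤z , _) , _) , z⋯y) = x≤z ∷ All.map (≤-trans x≤z) (Sat⇒All-≥ z⋯y)

  Sat-++ : ∀ {x p y} cs {ds} → Sat x cs p → Sat p ds y → Sat x (cs ++ ds) y
  Sat-++ []       refl        p⋯y = p⋯y
  Sat-++ (z ∷ cs) (x⋖z , z⋯p) p⋯y = x⋖z , Sat-++ cs z⋯p p⋯y

  Sat-refl⇒[] : ∀ {x cs} → Sat x cs x → cs ≡ []
  Sat-refl⇒[] {cs = []}    _                              = refl
  Sat-refl⇒[] {cs = _ ∷ _} (((x≤z , x≢z) , _) , z⋯x) = contradiction (antisym x≤z (Sat⇒≤ z⋯x)) x≢z

  Sat-exit : ∀ {u m x} rs → u ≤ m → ¬ x ≤ m → Sat u rs x →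
             ∃[ a ] ∃[ s ] (dropWhile (_≤? m) rs ≡ a ∷ s × u < a × Sat a s x)
  Sat-exit []       u≤m x≰m refl = contradiction u≤m x≰m
  Sat-exit {m = m} (z ∷ zs) u≤m x≰m (u⋖z , z⋯x) with z ≤? m
  ... | no _    = z , zs , refl , proj₁ u⋖z , z⋯x
  ... | yes z≤m with Sat-exit zs z≤m x≰m z⋯x
  ...   | a , s , eq , z<a , a⋯x = a , s , eq , <-≤-trans (proj₁ u⋖z) (proj₁ z<a) , a⋯x

  record Crossing (m x y : Carrier) (ds : List Carrier) : Set where
    field
      lower       : List Carrier
      p q         : Carrier
      upper       : List Carrier
      split       : ds ≡ lower ++ q ∷ upper
      lower-chain : Sat x lower p
      lower-below : All (_≤ m) lower
      p≤m         : p ≤ m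
      p⋖q         : p ⋖ q
      q≰m         : ¬ q ≤ m
      upper-chain : Sat q upper y

  crossing : ∀ {m x y} ds → x ≤ m → ¬ y ≤ m → Sat x ds y → Crossing m x y ds
  crossing []       x≤m y≰m refl = contradiction x≤m y≰m
  crossing {m} (z ∷ zs) x≤m y≰m (x⋖z , z⋯y) with z ≤? m
  ... | no z≰m = record
    { lower = [] ; p = _ ; q = z ; upper = zs ; split = refl ; lower-chain = refl
    ; lower-below = [] ; p≤m = x≤m ; p⋖q = x⋖z ; q≰m = z≰m ; upper-chain = z⋯y }
  ... | yes z≤m = record
    { lower = z ∷ lower ; p = p ; q = q ; upper = upper ; split = cong (z ∷_) split
    ; lower-chain = x⋖z , lower-chain ; lower-below = z≤m ∷ lower-below
    ; p≤m = p≤m ; p⋖q = p⋖q ; q≰m = q≰m ; upper-chain = upper-chain }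
    where open Crossing (crossing zs z≤m y≰m z⋯y)

  word-++ : ∀ lab rs cs ds → word lab rs (cs ++ ds) ≡ word lab rs cs ++ word lab (rs ++ cs) ds
  word-++ lab rs []       ds = cong (λ R → word lab R ds) (sym (++-identityʳ rs))
  word-++ lab rs (z ∷ cs) ds = cong (lab rs z ∷_) (begin
    word lab (rs ∷ʳ z) (cs ++ ds)
      ≡⟨ word-++ lab (rs ∷ʳ z) cs ds ⟩
    word lab (rs ∷ʳ z) cs ++ word lab ((rs ∷ʳ z) ++ cs) ds
      ≡⟨ cong (λ R → word lab (rs ∷ʳ z) cs ++ word lab R ds) (++-assoc rs [ z ] cs) ⟩
    word lab (rs ∷ʳ z) cs ++ word lab (rs ++ z ∷ cs) ds ∎)
    where open ≡-Reasoning

  word-cong : ∀ (f g : ChainEdgeLabeling) (Inv : Rel (List Carrier) 0ℓ)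
                (P : Pred Carrier 0ℓ) →
              (∀ {R R′ z} → Inv R R′ → Inv (R ∷ʳ z) (R′ ∷ʳ z)) →
              (∀ {R R′ z} → Inv R R′ → P z → f R z ≡ g R′ z) →
              ∀ {rs rs′} cs → Inv rs rs′ → All P cs → word f rs cs ≡ word g rs′ cs
  word-cong f g Inv P extend agree []       _   []         = refl
  word-cong f g Inv P extend agree (z ∷ cs) inv (pz ∷ pcs) =
    cong₂ _∷_ (agree inv pz) (word-cong f g Inv P extend agree cs (extend inv) pcs)

  word-All : ∀ {ℓ} {P : Pred ℤ ℓ} lab → (∀ R z → P (lab R z)) → ∀ rs cs → All P (word lab rs cs)
  word-All lab p rs []       = []
  word-All lab p rs (z ∷ cs) = p rs z ∷ word-All lab p (rs ∷ʳ z) cs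

  open FirstDifference _<ℤ_ public

  record CLChain (lab : ChainEdgeLabeling) (rs : List Carrier) (x y : Carrier) : Set where
    field
      chain      : List Carrier
      maximal    : Sat x chain y
      increasing : Increasing (word lab rs chain)
      unique     : ∀ ds → Sat x ds y → Increasing (word lab rs ds) → ds ≡ chain
      earliest   : ∀ ds → Sat x ds y → ds ≢ chain → word lab rs chain ≺ word lab rs ds

  IsCLOn : ChainEdgeLabeling → Carrier → Carrier → Set
  IsCLOn lab u v = ∀ {x y rs} → Sat u rs x → x ≤ y → y ≤ v → CLChain lab rs x y

  CLChain-refl : ∀ {lab rs x} → CLChain lab rs x x
  CLChain-refl = record
    { chain = [] ; maximal = refl ; increasing = []
    ; unique = λ ds x⋯x _ → Sat-refl⇒[] x⋯x
    ; earliest = λ ds x⋯x ds≢[] → contradiction (Sat-refl⇒[] x⋯x) ds≢[] }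

  CLChain-transfer : ∀ {f g rs rs′ x y} → (∀ ds → Sat x ds y → word f rs ds ≡ word g rs′ ds) →
                     CLChain g rs′ x y → CLChain f rs x y
  CLChain-transfer same c = record
    { chain = chain ; maximal = maximal
    ; increasing = subst Increasing (sym (same chain maximal)) increasing
    ; unique = λ ds x⋯y inc → unique ds x⋯y (subst Increasing (same ds x⋯y) inc)
    ; earliest = λ ds x⋯y ds≢ →
        subst₂ _≺_ (sym (same chain maximal)) (sym (same ds x⋯y)) (earliest ds x⋯y ds≢) }
    where open CLChain c

module CLLabeling (L : FiniteLattice) (comodernistic : FiniteLattice.Comodernistic L) where

  open FiniteLattice L
  open Chains L

  coatom : Carrier → Carrier → Carrier
  coatom u v with u <? v
  ... | yes u<v = proj₁ (comodernistic u v u<v)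
  ... | no  _   = v

  coatom-spec : ∀ {u v} → u < v → u ≤ coatom u v × coatom u v ⋖ v × LeftModularIn u v (coatom u v)
  coatom-spec {u} {v} u<v with u <? v
  ... | yes u<v′ = proj₂ (comodernistic u v u<v′)
  ... | no  u≮v  = contradiction u<v u≮v

  _∈[_,_]? : ∀ z u v → Dec (u ≤ z × z ≤ v)
  z ∈[ u , v ]? = (u ≤? z) ×-dec (z ≤? v)

  interval : Carrier → Carrier → Subset n
  interval u v = toSubset (_∈[ u , v ]?)

  ∣interval∣-< : ∀ {u v u′ v′ w} → u ≤ u′ → v′ ≤ v → u ≤ w → w ≤ v → ¬ (u′ ≤ w × w ≤ v′) →
                 (∣ interval u′ v′ ∣) ℕ.< (∣ interval u v ∣)
  ∣interval∣-< {u} {v} {u′} {v′} u≤u′ v′≤v u≤w w≤v w∉ =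
    ∣toSubset∣-< (_∈[ u′ , v′ ]?) (_∈[ u , v ]?)
      (λ (u′≤z , z≤v′) → ≤-trans u≤u′ u′≤z , ≤-trans z≤v′ v′≤v) (u≤w , w≤v) w∉

  ∣interval-coatom∣-< : ∀ {u v} → u < v → (∣ interval u (coatom u v) ∣) ℕ.< (∣ interval u v ∣)
  ∣interval-coatom∣-< u<v with coatom-spec u<v
  ... | _ , ((m≤v , m≢v) , _) , _ =
    ∣interval∣-< ≤-refl m≤v (proj₁ u<v) ≤-refl (λ (_ , v≤m) → m≢v (antisym m≤v v≤m))

  ∣interval-above∣-< : ∀ {u v a} → u < a → u ≤ v → (∣ interval a v ∣) ℕ.< (∣ interval u v ∣)
  ∣interval-above∣-< (u≤a , u≢a) u≤v =
    ∣interval∣-< u≤a ≤-refl ≤-refl u≤v (λ (a≤u , _) → u≢a (antisym u≤a a≤u))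

  -- The fuel k must be at least the size of [u,v]; the labels lie in [0, k].
  labeling : ℕ → Carrier → Carrier → ChainEdgeLabeling
  labeling zero    u v rs y = + 0
  labeling (suc k) u v rs y with y ≤? coatom u v | dropWhile (_≤? coatom u v) rs
  ... | yes _ | _     = labeling k u (coatom u v) rs y
  ... | no  _ | []    = + suc k
  ... | no  _ | a ∷ s = labeling k a v s y

  labeling-≤ : ∀ k u v rs y → labeling k u v rs y ≤ℤ + k
  labeling-≤ zero    u v rs y = ℤₚ.≤-refl
  labeling-≤ (suc k) u v rs y with y ≤? coatom u v | dropWhile (_≤? coatom u v) rs
  ... | yes _ | _     = ℤₚ.≤-trans (labeling-≤ k u (coatom u v) rs y) (+≤+ (ℕₚ.n≤1+n k))
  ... | no  _ | []    = ℤₚ.≤-refl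
  ... | no  _ | a ∷ s = ℤₚ.≤-trans (labeling-≤ k a v s y) (+≤+ (ℕₚ.n≤1+n k))

  labeling-< : ∀ k u v rs y → labeling k u v rs y <ℤ + suc k
  labeling-< k u v rs y = ℤₚ.≤-<-trans (labeling-≤ k u v rs y) (+<+ (ℕₚ.n<1+n k))

  labeling-below : ∀ {k u v rs y} → y ≤ coatom u v →
                   labeling (suc k) u v rs y ≡ labeling k u (coatom u v) rs y
  labeling-below {k} {u} {v} {rs} {y} y≤m with y ≤? coatom u v | dropWhile (_≤? coatom u v) rs
  ... | yes _   | _ = refl
  ... | no  y≰m | _ = contradiction y≤m y≰m

  labeling-leave : ∀ {k u v rs y} → ¬ y ≤ coatom u v → All (_≤ coatom u v) rs →
                   labeling (suc k) u v rs y ≡ + suc k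
  labeling-leave {k} {u} {v} {rs} {y} y≰m rs≤m
    with y ≤? coatom u v | dropWhile (_≤? coatom u v) rs | dropWhile-All (_≤? coatom u v) rs≤m
  ... | yes y≤m | _  | _    = contradiction y≤m y≰m
  ... | no  _   | [] | refl = refl

  labeling-above : ∀ {k u v rs y a s} → ¬ y ≤ coatom u v → dropWhile (_≤? coatom u v) rs ≡ a ∷ s →
                   labeling (suc k) u v rs y ≡ labeling k a v s y
  labeling-above {k} {u} {v} {rs} {y} y≰m rs-leaves
    with y ≤? coatom u v | dropWhile (_≤? coatom u v) rs | rs-leaves
  ... | yes y≤m | _     | _    = contradiction y≤m y≰m
  ... | no  _   | _ ∷ _ | refl = refl

  module InductionStep
    (k : ℕ) (IH : ∀ {u v} → (∣ interval u v ∣) ℕ.≤ k → IsCLOn (labeling k u v) u v)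
    {u v : Carrier} (size : (∣ interval u v ∣) ℕ.≤ suc k) (u<v : u < v) where

    m : Carrier
    m = coatom u v

    u≤m : u ≤ m
    u≤m = proj₁ (coatom-spec u<v)

    m⋖v : m ⋖ v
    m⋖v = proj₁ (proj₂ (coatom-spec u<v))

    leftModular : LeftModularIn u v m
    leftModular = proj₂ (proj₂ (coatom-spec u<v))

    f below : ChainEdgeLabeling
    f     = labeling (suc k) u v
    below = labeling k u m

    IH-below : IsCLOn below u m
    IH-below = IH (ℕₚ.≤-pred (ℕₚ.<-≤-trans (∣interval-coatom∣-< u<v) size))

    IH-above : ∀ {a} → u < a → IsCLOn (labeling k a v) a v
    IH-above u<a = IH (ℕₚ.≤-pred (ℕₚ.<-≤-trans (∣interval-above∣-< u<a (proj₁ u<v)) size))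

    word-below : ∀ rs cs → All (_≤ m) cs → word f rs cs ≡ word below rs cs
    word-below rs cs =
      word-cong f below _≡_ (_≤ m) (λ { refl → refl }) (λ { refl → labeling-below }) cs refl

    word-above : ∀ {rs a s} cs → dropWhile (_≤? m) rs ≡ a ∷ s → All (λ z → ¬ z ≤ m) cs →
                 word f rs cs ≡ word (labeling k a v) s cs
    word-above {a = a} cs =
      word-cong f (labeling k a v) (λ R R′ → dropWhile (_≤? m) R ≡ a ∷ R′) (λ z → ¬ z ≤ m)
        (λ {R} {_} {z} → dropWhile-++-∷ (_≤? m) R [ z ])
        (λ leaves z≰m → labeling-above z≰m leaves) cs

    below-coatom : ∀ {x y rs} → Sat u rs x → x ≤ y → y ≤ m → CLChain f rs x y
    below-coatom u⋯x x≤y y≤m = CLChain-transfer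
      (λ ds x⋯y → word-below _ ds (All.map (λ z≤y → ≤-trans z≤y y≤m) (Sat⇒All-≤ x⋯y)))
      (IH-below u⋯x x≤y y≤m)

    above-coatom : ∀ {x y rs} → Sat u rs x → x ≤ y → y ≤ v → ¬ x ≤ m → CLChain f rs x y
    above-coatom {rs = rs} u⋯x x≤y y≤v x≰m with Sat-exit rs u≤m x≰m u⋯x
    ... | a , s , leaves , u<a , a⋯x = CLChain-transfer
      (λ ds x⋯y → word-above ds leaves
                    (All.map (λ x≤z z≤m → x≰m (≤-trans x≤z z≤m)) (Sat⇒All-≥ x⋯y)))
      (IH-above u<a a⋯x x≤y y≤v)

    module AcrossCoatom {x y rs} (u⋯x : Sat u rs x) (x≤y : x ≤ y) (y≤v : y ≤ v)
                        (x≤m : x ≤ m) (y≰m : ¬ y ≤ m) where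

      K : ℤ
      K = + suc k

      m∧y⋖y : (m ∧ y) ⋖ y
      m∧y⋖y = ∧-⋖ leftModular u≤m m⋖v (≤-trans (Sat⇒≤ u⋯x) x≤y) y≤v y≰m

      rs≤m : All (_≤ m) rs
      rs≤m = All.map (λ z≤x → ≤-trans z≤x x≤m) (Sat⇒All-≤ u⋯x)

      lowest : CLChain below rs x (m ∧ y)
      lowest = IH-below u⋯x (∧-greatest x≤m x≤y) (x∧y≤x m y)

      open CLChain lowest renaming (chain to c₀; maximal to c₀-maximal; increasing to c₀-increasing;
                                    unique to c₀-unique; earliest to c₀-earliest)

      c₀≤m : All (_≤ m) c₀
      c₀≤m = All.map (λ z≤m∧y → ≤-trans z≤m∧y (x∧y≤x m y)) (Sat⇒All-≤ c₀-maximal)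

      c₀<K : All (_<ℤ K) (word below rs c₀)
      c₀<K = word-All below (labeling-< k u m) rs c₀

      word-crossing : ∀ lo q up → All (_≤ m) lo → ¬ q ≤ m → Sat q up y →
                      word f rs (lo ++ q ∷ up) ≡ word below rs lo ++ K ∷ word (labeling k q v) [] up
      word-crossing lo q up lo≤m q≰m q⋯y = begin
        word f rs (lo ++ q ∷ up)
          ≡⟨ word-++ f rs lo (q ∷ up) ⟩
        word f rs lo ++ f (rs ++ lo) q ∷ word f ((rs ++ lo) ∷ʳ q) up
          ≡⟨ cong₂ _++_ (word-below rs lo lo≤m)
                        (cong₂ _∷_ (labeling-leave q≰m rs++lo≤m) (word-above up leaves up≰m)) ⟩
        word below rs lo ++ K ∷ word (labeling k q v) [] up ∎
        where
        open ≡-Reasoning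
        rs++lo≤m : All (_≤ m) (rs ++ lo)
        rs++lo≤m = ++⁺ rs≤m lo≤m
        leaves : dropWhile (_≤? m) ((rs ++ lo) ∷ʳ q) ≡ q ∷ []
        leaves = trans (dropWhile-++-All (_≤? m) [ q ] rs++lo≤m) (dropWhile-¬ (_≤? m) [] q≰m)
        up≰m : All (λ z → ¬ z ≤ m) up
        up≰m = All.map (λ q≤z z≤m → q≰m (≤-trans q≤z z≤m)) (Sat⇒All-≥ q⋯y)

      candidate : List Carrier
      candidate = c₀ ∷ʳ y

      candidate-word : word f rs candidate ≡ word below rs c₀ ∷ʳ K
      candidate-word = word-crossing c₀ y [] c₀≤m y≰m refl

      candidate-increasing : Increasing (word f rs candidate)
      candidate-increasing = subst Increasing (sym candidate-word) (Linked-∷ʳ _ c₀-increasing c₀<K)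

      -- An increasing chain has to leave ↓m at its last step, and then through m ∧ y.
      unique-crossing : ∀ {ds} → Crossing m x y ds → Increasing (word f rs ds) → ds ≡ candidate
      unique-crossing record { lower = lo ; p = p ; upper = [] ; split = refl
                             ; lower-chain = x⋯p ; lower-below = lo≤m ; p≤m = p≤m ; p⋖q = p⋖y
                             ; upper-chain = refl } inc =
        cong (_∷ʳ y)
          (c₀-unique lo (subst (Sat x lo) p≡m∧y x⋯p) (Linked-++⁻ˡ (word below rs lo) inc′))
        where
        inc′ : Increasing (word below rs lo ++ K ∷ [])
        inc′ = subst Increasing (word-crossing lo y [] lo≤m y≰m refl) inc
        p≡m∧y : p ≡ m ∧ y
        p≡m∧y = ⋖-≤-<⇒≡ p⋖y (∧-greatest p≤m (proj₁ (proj₁ p⋖y))) (proj₁ m∧y⋖y)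
      unique-crossing record { lower = lo ; q = q ; upper = w ∷ up ; split = refl
                             ; lower-below = lo≤m ; q≰m = q≰m ; upper-chain = q⋯y } inc =
        contradiction (labeling-< k q v [] w) (ℤₚ.<-asym K<w)
        where
        inc′ : Increasing (word below rs lo ++ K ∷ word (labeling k q v) [] (w ∷ up))
        inc′ = subst Increasing (word-crossing lo q (w ∷ up) lo≤m q≰m q⋯y) inc
        K<w : K <ℤ labeling k q v [] w
        K<w = Linked.head (Linked-++⁻ʳ (word below rs lo) inc′)

      through-m∧y : ∀ lo {q up} → lo ≡ c₀ → (m ∧ y) < q → Sat q up y → lo ++ q ∷ up ≡ candidate
      through-m∧y lo {q} {up} lo≡c₀ m∧y<q q⋯y =
        cong₂ _++_ lo≡c₀ (cong₂ _∷_ q≡y (Sat-refl⇒[] (subst (λ q → Sat q up y) q≡y q⋯y)))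
        where
        q≡y : q ≡ y
        q≡y with q ≟ᶠ y
        ... | yes q≡y = q≡y
        ... | no  q≢y = contradiction (m∧y<q , (Sat⇒≤ q⋯y , q≢y)) (proj₂ m∧y⋖y q)

      -- Compare c₀ with the chain lo ++ e of [x, m ∧ y], for any maximal chain e of [p, m ∧ y].
      earliest-crossing : ∀ {ds} → Crossing m x y ds → ds ≢ candidate →
                          word f rs candidate ≺ word f rs ds
      earliest-crossing record { lower = lo ; p = p ; q = q ; upper = up ; split = refl
                               ; lower-chain = x⋯p ; lower-below = lo≤m ; p≤m = p≤m ; p⋖q = p⋖q
                               ; q≰m = q≰m ; upper-chain = q⋯y } ds≢ =
        subst₂ _≺_ (sym candidate-word) (sym (word-crossing lo q up lo≤m q≰m q⋯y))
               (compare ext p⋯m∧y (≡-dec _≟ᶠ_ (lo ++ ext) c₀))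
        where
        wl wu : List ℤ
        wl = word below rs lo
        wu = word (labeling k q v) [] up

        p≤m∧y : p ≤ (m ∧ y)
        p≤m∧y = ∧-greatest p≤m (≤-trans (proj₁ (proj₁ p⋖q)) (Sat⇒≤ q⋯y))

        open CLChain (IH-below (Sat-++ rs u⋯x x⋯p) p≤m∧y (x∧y≤x m y))
          using () renaming (chain to ext; maximal to p⋯m∧y)

        compare : ∀ e → Sat p e (m ∧ y) → Dec (lo ++ e ≡ c₀) → word below rs c₀ ∷ʳ K ≺ wl ++ K ∷ wu
        compare e p⋯m∧y (no lo++e≢c₀) = ≺-insert wl wu c₀<K
          (subst (word below rs c₀ ≺_) (word-++ below rs lo e)
                 (c₀-earliest (lo ++ e) (Sat-++ lo x⋯p p⋯m∧y) lo++e≢c₀))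
        compare (z ∷ e) _ (yes lo++e≡c₀) =
          subst (_≺ wl ++ K ∷ wu) (sym c₀-word) (≺-++ˡ wl (here (labeling-< k u m (rs ++ lo) z)))
          where
          open ≡-Reasoning
          c₀-word : word below rs c₀ ∷ʳ K
                    ≡ wl ++ (below (rs ++ lo) z ∷ word below ((rs ++ lo) ∷ʳ z) e ∷ʳ K)
          c₀-word = begin
            word below rs c₀ ∷ʳ K
              ≡⟨ cong (λ c → word below rs c ∷ʳ K) (sym lo++e≡c₀) ⟩
            word below rs (lo ++ z ∷ e) ∷ʳ K
              ≡⟨ cong (_∷ʳ K) (word-++ below rs lo (z ∷ e)) ⟩
            (wl ++ word below (rs ++ lo) (z ∷ e)) ∷ʳ K
              ≡⟨ ++-assoc wl _ [ K ] ⟩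
            wl ++ (below (rs ++ lo) z ∷ word below ((rs ++ lo) ∷ʳ z) e ∷ʳ K) ∎
        compare [] p≡m∧y (yes lo≡c₀) = contradiction
          (through-m∧y lo (trans (sym (++-identityʳ lo)) lo≡c₀)
                          (subst (_< q) p≡m∧y (proj₁ p⋖q)) q⋯y)
          ds≢

      result : CLChain f rs x y
      result = record
        { chain      = candidate
        ; maximal    = Sat-++ c₀ c₀-maximal (m∧y⋖y , refl)
        ; increasing = candidate-increasing
        ; unique     = λ ds x⋯y → unique-crossing (crossing ds x≤m y≰m x⋯y)
        ; earliest   = λ ds x⋯y → earliest-crossing (crossing ds x≤m y≰m x⋯y) }

    cases : ∀ {x y rs} → Sat u rs x → x ≤ y → y ≤ v → CLChain f rs x y
    cases {x} {y} u⋯x x≤y y≤v with y ≤? m | x ≤? m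
    ... | yes y≤m | _       = below-coatom u⋯x x≤y y≤m
    ... | no  _   | no  x≰m = above-coatom u⋯x x≤y y≤v x≰m
    ... | no  y≰m | yes x≤m = AcrossCoatom.result u⋯x x≤y y≤v x≤m y≰m

  labeling-isCLOn : ∀ k {u v} → (∣ interval u v ∣) ℕ.≤ k → IsCLOn (labeling k u v) u v
  labeling-isCLOn zero {u} {v} size {x} {y} u⋯x x≤y y≤v with x ≟ᶠ y
  ... | yes refl = CLChain-refl
  ... | no  x≢y  = contradiction (ℕₚ.<-≤-trans (∣interval-coatom∣-< u<v) size) ℕₚ.n≮0
    where
    u<v : u < v
    u<v = ≤-<-trans (Sat⇒≤ u⋯x) (<-≤-trans (x≤y , x≢y) y≤v)
  labeling-isCLOn (suc k) {u} {v} size {x} {y} u⋯x x≤y y≤v with x ≟ᶠ y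
  ... | yes refl = CLChain-refl
  ... | no  x≢y  = InductionStep.cases k (labeling-isCLOn k) size u<v u⋯x x≤y y≤v
    where
    u<v : u < v
    u<v = ≤-<-trans (Sat⇒≤ u⋯x) (<-≤-trans (x≤y , x≢y) y≤v)

  hasCLLabeling : HasCLLabeling
  hasCLLabeling = labeling K bot top , isCL
    where
    K : ℕ
    K = ∣ interval bot top ∣
    isCL : IsCL (labeling K bot top)
    isCL x y rs bot⋯x x≤y =
      chain , maximal , increasing , unique , λ ds x⋯y ds≢ → ≺⇒Lex-< (earliest ds x⋯y ds≢)
      where open CLChain (labeling-isCLOn K ℕₚ.≤-refl bot⋯x x≤y (maximum y))

theorem1p2 : (L : FiniteLattice) → FiniteLattice.Comodernistic L → FiniteLattice.HasCLLabeling L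
theorem1p2 L comodernistic = CLLabeling.hasCLLabeling L comodernistic
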